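{- Let $g,h\in[0,d]$ with $g\cup h\le_2\widetilde d$. Then $C_gC_h=\overline{k_{g\cap h}}\,C_{g\cup h}$.
   Context: Let $n\ge1$ and let $\mathbb U_1,\dots,\mathbb U_n$ be finite sets with $|\mathbb U_a|=u_a\ge2$. Put $\mathbb X=\prod_a\mathbb U_a$, $d=2^n-1$. For $g\in[0,d]$ with binary expansion $g=\sum_{a=1}^n g_{(a)}2^{a-1}$ let $\mathbb P(g)=\{a:g_{(a)}=1\}$, and $R_g=\{(\mathbf u,\mathbf v)\in\mathbb X^2:\mathbf u_a\ne\mathbf v_a\iff a\in\mathbb P(g)\}$ (factorial association scheme); $k_g=|\{\mathbf w:(\mathbf u,\mathbf w)\in R_g\}|$. For $g,h\in[0,d]$: $g\le_2h$ iff $\mathbb P(g)\subseteq\mathbb P(h)$; $g\cup h,g\cap h,g\setminus h$ are the elements whose $\mathbb P$ is the union, intersection, difference; $g\oplus h=(g\setminus h)\cup(h\setminus g)$; $\widetilde g$ has $\mathbb P(\widetilde g)=\{a\in\mathbb P(g):u_a>2\}$. $\mathbb F$ is a field and $\overline m$ the image of $m\in\mathbb Z$. $A_g$ is the $\{0,1\}$ adjacency matrix of $R_g$ over $\mathbb F$; fixing $\mathbf x\in\mathbb X$, $E_g^*$ is the diagonal $\{0,1\}$-matrix with $E_g^*(\mathbf u,\mathbf u)=1$ iff $(\mathbf x,\mathbf u)\in R_g$. $B_{g,h,i}=\sum_{j:\ g\oplus i\le_2j\le_2h}E_g^*A_jE_i^*$. For $g\le_2\widetilde d$, $C_g=\sum_{i=0}^d\overline{k_{g\setminus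 i}}\,B_{i,g\cap i,i}$. -}

module Defs where

open import Level using (Level; _⊔_)
open import Data.Nat using (ℕ; zero; suc; _<?_)
open import Data.Product using (∃)
open import Data.Fin using (Fin; zero; suc)
open import Data.Fin.Properties using () renaming (_≟_ to _≟F_)
open import Data.Fin.Subset using (Subset; _∪_; _∩_; _─_; _⊆_)
open import Data.Fin.Subset.Properties using (_⊆?_)
open import Data.Bool using (Bool; true; false; _∧_; _xor_; if_then_else_)
open import Data.List using (List; []; _∷_; [_]; map; concatMap; allFin)
open import Data.Vec using (Vec; []; _∷_; tabulate)
open import Relation.Nullary.Decidable using (isYes)
open import Relation.Nullary using (¬_)
open import Algebra.Bundles using (CommutativeRing)

record Field (c ℓ : Level) : Set (Level.suc (c ⊔ ℓ)) where
  field
    commutativeRing : CommutativeRing c ℓ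
  open CommutativeRing commutativeRing public
  field
    0≉1     : ¬ (0# ≈ 1#)
    inverse : ∀ a → ¬ (a ≈ 0#) → ∃ λ b → (a * b) ≈ 1#

X : (n : ℕ) → (Fin n → ℕ) → Set
X n u = (a : Fin n) → Fin (u a)

consX : ∀ {n} {u : Fin (suc n) → ℕ} → Fin (u zero) → X n (λ a → u (suc a)) → X (suc n) u
consX i f zero    = i
consX i f (suc a) = f a

allX : (n : ℕ) (u : Fin n → ℕ) → List (X n u)
allX zero    u = [ (λ ()) ]
allX (suc n) u = concatMap (λ i → map (consX i) (allX n (λ a → u (suc a)))) (allFin (u zero))

-- all subsets of [1..n]; a subset g ⊆ Fin n encodes the integer
-- g ∈ [0, 2^n - 1] via its binary expansion, i.e. g is  P(g).
allSub : (n : ℕ) → List (Subset n)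
allSub zero    = [ [] ]
allSub (suc n) = concatMap (λ s → (true ∷ s) ∷ (false ∷ s) ∷ []) (allSub n)

_⊕_ : ∀ {n} → Subset n → Subset n → Subset n
g ⊕ h = (g ─ h) ∪ (h ─ g)

-- d̃ : the set of coordinates a with u_a > 2  (d itself is the full set)
dTilde : (n : ℕ) → (Fin n → ℕ) → Subset n
dTilde n u = tabulate (λ a → isYes (2 <? u a))

allFinB : (n : ℕ) → (Fin n → Bool) → Bool
allFinB zero    p = true
allFinB (suc n) p = p zero ∧ allFinB n (λ a → p (suc a))

eqX : ∀ {n u} → X n u → X n u → Bool
eqX {n} v w = allFinB n (λ a → isYes (v a ≟F w a))

relR : ∀ {n u} → Subset n → X n u → X n u → Bool
relR {n} g v w = allFinB n (λ a → isYes (v a ≟F w a) xor Data.Vec.lookup g a)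

count : ∀ {A : Set} → (A → Bool) → List A → ℕ
count p []       = 0
count p (w ∷ ws) = if p w then suc (count p ws) else count p ws

module Scheme {c ℓ} (F : Field c ℓ) (n : ℕ) (u : Fin n → ℕ) (x : X n u) where
  open Field F

  Mat : Set c
  Mat = X n u → X n u → Carrier

  _≈M_ : Mat → Mat → Set ℓ
  M ≈M N = ∀ v w → M v w ≈ N v w

  sumL : ∀ {A : Set} → List A → (A → Carrier) → Carrier
  sumL []       f = 0#
  sumL (a ∷ as) f = f a + sumL as f

  ⟦_⟧ : ℕ → Carrier
  ⟦ zero  ⟧ = 0#
  ⟦ suc m ⟧ = 1# + ⟦ m ⟧

  0M : Mat
  0M v w = 0#

  _+M_ : Mat → Mat → Mat
  (M +M N) v w = M v w + N v w

  _*M_ : Mat → Mat → Mat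
  (M *M N) v w = sumL (allX n u) (λ z → M v z * N z w)

  _•M_ : Carrier → Mat → Mat
  (s •M M) v w = s * M v w

  sumM : ∀ {A : Set} → List A → (A → Mat) → Mat
  sumM []       f = 0M
  sumM (a ∷ as) f = f a +M sumM as f

  A : Subset n → Mat
  A g v w = if relR g v w then 1# else 0#

  E* : Subset n → Mat
  E* g v w = if eqX v w ∧ relR g x v then 1# else 0#

  k : Subset n → ℕ
  k g = count (relR g x) (allX n u)

  B : Subset n → Subset n → Subset n → Mat
  B g h i = sumM (allSub n)
              (λ j → if isYes ((g ⊕ i) ⊆? j) ∧ isYes (j ⊆? h)
                       then (E* g *M A j) *M E* i
                       else 0M)

  C : Subset n → Mat
  C g = sumM (allSub n) (λ i → ⟦ k (g ─ i) ⟧ •M B i (g ∩ i) i)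

{-# OPTIONS --safe #-}
module Submission where

-- Everything in the statement is a Kronecker product over the n coordinates: the sums over X and
-- over the subsets of [1..n] split coordinatewise, so E*_g, A_g and k_g, hence B_{g,h,i} and C_g,
-- factor into their analogues for a single coordinate Fin m with base point b.  There C₁ false is
-- the identity and C₁ true = (m − 1)·e_b e_bᵀ + J, where J is the all-ones matrix on the points
-- other than b.  The two summands are orthogonal, e_b e_bᵀ is idempotent and J² = (m − 1)·J, so
-- C₁ true² = (m − 1)·C₁ true; induction on n gives C_g C_h = k_{g∩h} C_{g∪h}.

open import Level using (Level)
open import Algebra.Bundles using (CommutativeSemiring)
open import Data.Bool using (Bool; true; false; _∧_; _∨_; _xor_; if_then_else_)
open import Data.Bool.Properties using (xor-identityʳ)
open import Data.Fin using (Fin; zero; suc)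
open import Data.Fin.Properties using (_≟_; suc-injective)
open import Data.Fin.Subset using (Subset; _∪_; _∩_; _─_; _⊆_)
open import Data.Fin.Subset.Properties using (_⊆?_)
open import Data.List using (List; []; _∷_; map; concatMap; allFin; _++_)
open import Data.List.Properties using (map-tabulate)
open import Data.Nat using (ℕ; zero; suc; _≤_)
open import Data.Vec using (head; []; _∷_)
open import Function using (_∘_; id)
open import Relation.Binary.PropositionalEquality as ≡ using (_≡_; _≢_)
open import Relation.Nullary using (yes; no; contradiction)
open import Relation.Nullary.Decidable using (isYes; ⌊⌋-map′)

open import Defs

module Sums {c ℓ} (R : CommutativeSemiring c ℓ) where
  open CommutativeSemiring R hiding (zero)
  open import Relation.Binary.Reasoning.Setoid setoid
  open import Algebra.Properties.CommutativeSemigroup *-commutativeSemigroup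
    using () renaming (interchange to *-interchange)
  open import Algebra.Properties.CommutativeSemigroup +-commutativeSemigroup
    using () renaming (interchange to +-interchange)

  ∑ : {A : Set} → List A → (A → Carrier) → Carrier
  ∑ []       f = 0#
  ∑ (a ∷ as) f = f a + ∑ as f

  ∑-cong : ∀ {A : Set} (L : List A) {f g : A → Carrier}
         → (∀ a → f a ≈ g a) → ∑ L f ≈ ∑ L g
  ∑-cong []      f≈g = refl
  ∑-cong (a ∷ L) f≈g = +-cong (f≈g a) (∑-cong L f≈g)

  ∑-zero : ∀ {A : Set} (L : List A) → ∑ L (λ _ → 0#) ≈ 0#
  ∑-zero []      = refl
  ∑-zero (a ∷ L) = trans (+-identityˡ _) (∑-zero L)

  ∑-*ˡ : ∀ {A : Set} (L : List A) s (f : A → Carrier) → ∑ L (λ a → s * f a) ≈ s * ∑ L f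
  ∑-*ˡ []      s f = sym (zeroʳ s)
  ∑-*ˡ (a ∷ L) s f = trans (+-cong refl (∑-*ˡ L s f)) (sym (distribˡ s _ _))

  ∑-*ʳ : ∀ {A : Set} (L : List A) s (f : A → Carrier) → ∑ L (λ a → f a * s) ≈ ∑ L f * s
  ∑-*ʳ []      s f = sym (zeroˡ s)
  ∑-*ʳ (a ∷ L) s f = trans (+-cong refl (∑-*ʳ L s f)) (sym (distribʳ s _ _))

  ∑-+ : ∀ {A : Set} (L : List A) (f g : A → Carrier) → ∑ L (λ a → f a + g a) ≈ ∑ L f + ∑ L g
  ∑-+ []      f g = sym (+-identityˡ 0#)
  ∑-+ (a ∷ L) f g = trans (+-cong refl (∑-+ L f g)) (+-interchange _ _ _ _)

  ∑-++ : ∀ {A : Set} (L M : List A) (f : A → Carrier) → ∑ (L ++ M) f ≈ ∑ L f + ∑ M f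
  ∑-++ []      M f = sym (+-identityˡ _)
  ∑-++ (a ∷ L) M f = trans (+-cong refl (∑-++ L M f)) (sym (+-assoc _ _ _))

  ∑-map : ∀ {A B : Set} (h : A → B) (L : List A) (f : B → Carrier)
        → ∑ (map h L) f ≡ ∑ L (f ∘ h)
  ∑-map h []      f = ≡.refl
  ∑-map h (a ∷ L) f = ≡.cong (f (h a) +_) (∑-map h L f)

  ∑-concatMap : ∀ {A B : Set} (G : A → List B) (L : List A) (f : B → Carrier)
              → ∑ (concatMap G L) f ≈ ∑ L (λ a → ∑ (G a) f)
  ∑-concatMap G []      f = refl
  ∑-concatMap G (a ∷ L) f = trans (∑-++ (G a) (concatMap G L) f) (+-cong refl (∑-concatMap G L f))

  ∑-product : ∀ {A B : Set} (L : List A) (M : List B) (α : A → Carrier) (β : B → Carrier)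
            → ∑ L (λ a → ∑ M (λ b → α a * β b)) ≈ ∑ L α * ∑ M β
  ∑-product L M α β = trans (∑-cong L (λ a → ∑-*ˡ M (α a) β)) (∑-*ʳ L (∑ M β) α)

  ∑-concatMap-map-separable : ∀ {A B C : Set} (L : List A) (M : List B) (g : A → B → C)
                              (f : C → Carrier) (α : A → Carrier) (β : B → Carrier)
                            → (∀ a b → f (g a b) ≈ α a * β b)
                            → ∑ (concatMap (λ a → map (g a) M) L) f ≈ ∑ L α * ∑ M β
  ∑-concatMap-map-separable L M g f α β f≈αβ = begin
    ∑ (concatMap (λ a → map (g a) M) L) f    ≈⟨ ∑-concatMap _ L f ⟩
    ∑ L (λ a → ∑ (map (g a) M) f)            ≈⟨ ∑-cong L (λ a → reflexive (∑-map (g a) M f)) ⟩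
    ∑ L (λ a → ∑ M (λ b → f (g a b)))        ≈⟨ ∑-cong L (λ a → ∑-cong M (f≈αβ a)) ⟩
    ∑ L (λ a → ∑ M (λ b → α a * β b))        ≈⟨ ∑-product L M α β ⟩
    ∑ L α * ∑ M β                            ∎

  ∑-allFin-suc : ∀ {m} (f : Fin (suc m) → Carrier)
               → ∑ (allFin (suc m)) f ≡ f zero + ∑ (allFin m) (f ∘ suc)
  ∑-allFin-suc {m} f = ≡.cong (f zero +_)
    (≡.trans (≡.cong (λ L → ∑ L f) (≡.sym (map-tabulate id suc))) (∑-map suc (allFin m) f))

  ∑-allFin-single : ∀ {m} (p : Fin m) (f : Fin m → Carrier) → (∀ r → r ≢ p → f r ≈ 0#)
                  → ∑ (allFin m) f ≈ f p
  ∑-allFin-single {suc m} zero f vanish = begin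
    ∑ (allFin (suc m)) f                   ≡⟨ ∑-allFin-suc f ⟩
    f zero + ∑ (allFin m) (f ∘ suc)        ≈⟨ +-cong refl (∑-cong (allFin m) (λ r → vanish (suc r) λ ())) ⟩
    f zero + ∑ (allFin m) (λ _ → 0#)       ≈⟨ +-cong refl (∑-zero (allFin m)) ⟩
    f zero + 0#                            ≈⟨ +-identityʳ _ ⟩
    f zero                                 ∎
  ∑-allFin-single {suc m} (suc p) f vanish = begin
    ∑ (allFin (suc m)) f                   ≡⟨ ∑-allFin-suc f ⟩
    f zero + ∑ (allFin m) (f ∘ suc)        ≈⟨ +-cong (vanish zero λ ()) refl ⟩
    0# + ∑ (allFin m) (f ∘ suc)            ≈⟨ +-identityˡ _ ⟩
    ∑ (allFin m) (f ∘ suc)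
      ≈⟨ ∑-allFin-single p (f ∘ suc) (λ r r≢p → vanish (suc r) (r≢p ∘ suc-injective)) ⟩
    f (suc p)                              ∎

  ι : ℕ → Carrier
  ι zero    = 0#
  ι (suc m) = 1# + ι m

  𝟙 : Bool → Carrier
  𝟙 a = if a then 1# else 0#

  if-then-0≈𝟙* : ∀ a x → (if a then x else 0#) ≈ 𝟙 a * x
  if-then-0≈𝟙* true  x = sym (*-identityˡ x)
  if-then-0≈𝟙* false x = sym (zeroˡ x)

  𝟙-∧ : ∀ a b → 𝟙 (a ∧ b) ≈ 𝟙 a * 𝟙 b
  𝟙-∧ true  b = sym (*-identityˡ _)
  𝟙-∧ false b = sym (zeroˡ _)

  𝟙-∧-interchange : ∀ a b c d → 𝟙 ((a ∧ b) ∧ (c ∧ d)) ≈ 𝟙 (a ∧ c) * 𝟙 (b ∧ d)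
  𝟙-∧-interchange a b c d = begin
    𝟙 ((a ∧ b) ∧ (c ∧ d))         ≈⟨ trans (𝟙-∧ _ _) (*-cong (𝟙-∧ a b) (𝟙-∧ c d)) ⟩
    (𝟙 a * 𝟙 b) * (𝟙 c * 𝟙 d)     ≈⟨ *-interchange _ _ _ _ ⟩
    (𝟙 a * 𝟙 c) * (𝟙 b * 𝟙 d)     ≈⟨ sym (*-cong (𝟙-∧ a c) (𝟙-∧ b d)) ⟩
    𝟙 (a ∧ c) * 𝟙 (b ∧ d)         ∎

  if-∧-interchange : ∀ a b c d {x y z} → x ≈ y * z
                   → (if (a ∧ b) ∧ (c ∧ d) then x else 0#)
                     ≈ (if a ∧ c then y else 0#) * (if b ∧ d then z else 0#)
  if-∧-interchange a b c d {x} {y} {z} x≈yz = begin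
    (if (a ∧ b) ∧ (c ∧ d) then x else 0#)   ≈⟨ if-then-0≈𝟙* _ x ⟩
    𝟙 ((a ∧ b) ∧ (c ∧ d)) * x               ≈⟨ *-cong (𝟙-∧-interchange a b c d) x≈yz ⟩
    (𝟙 (a ∧ c) * 𝟙 (b ∧ d)) * (y * z)       ≈⟨ *-interchange _ _ _ _ ⟩
    (𝟙 (a ∧ c) * y) * (𝟙 (b ∧ d) * z)       ≈⟨ sym (*-cong (if-then-0≈𝟙* _ y) (if-then-0≈𝟙* _ z)) ⟩
    (if a ∧ c then y else 0#) * (if b ∧ d then z else 0#) ∎

  𝟙-idem : ∀ a → 𝟙 a * 𝟙 a ≈ 𝟙 a
  𝟙-idem true  = *-identityˡ 1#
  𝟙-idem false = zeroˡ 0#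

  𝟙-xor-disjoint : ∀ a → 𝟙 (a xor false) * 𝟙 (a xor true) ≈ 0#
  𝟙-xor-disjoint true  = zeroʳ 1#
  𝟙-xor-disjoint false = zeroˡ 1#

  𝟙-xor-cover : ∀ a → 𝟙 (a xor true) + 𝟙 (a xor false) ≈ 1#
  𝟙-xor-cover true  = +-identityˡ 1#
  𝟙-xor-cover false = +-identityʳ 1#

  ι-count : ∀ {A : Set} (p : A → Bool) (L : List A) → ι (count p L) ≈ ∑ L (𝟙 ∘ p)
  ι-count p []      = refl
  ι-count p (a ∷ L) with p a
  ... | true  = +-cong refl (ι-count p L)
  ... | false = trans (ι-count p L) (sym (+-identityˡ _))

  𝟙-≟-diag : ∀ {m} (r : Fin m) → 𝟙 (isYes (r ≟ r)) ≈ 1#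
  𝟙-≟-diag r with r ≟ r
  ... | yes _   = refl
  ... | no r≢r = contradiction ≡.refl r≢r

  𝟙-≟-off : ∀ {m} {p r : Fin m} → p ≢ r → 𝟙 (isYes (p ≟ r)) ≈ 0#
  𝟙-≟-off {p = p} {r} p≢r with p ≟ r
  ... | yes p≡r = contradiction p≡r p≢r
  ... | no  _   = refl

  ∑-𝟙-≟ˡ : ∀ {m} (p : Fin m) (f : Fin m → Carrier)
         → ∑ (allFin m) (λ r → 𝟙 (isYes (p ≟ r)) * f r) ≈ f p
  ∑-𝟙-≟ˡ p f = begin
    ∑ (allFin _) (λ r → 𝟙 (isYes (p ≟ r)) * f r)
      ≈⟨ ∑-allFin-single p _ (λ r r≢p → trans (*-cong (𝟙-≟-off (r≢p ∘ ≡.sym)) refl) (zeroˡ (f r))) ⟩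
    𝟙 (isYes (p ≟ p)) * f p   ≈⟨ trans (*-cong (𝟙-≟-diag p) refl) (*-identityˡ (f p)) ⟩
    f p                       ∎

  ∑-𝟙-≟ʳ : ∀ {m} (q : Fin m) (f : Fin m → Carrier)
         → ∑ (allFin m) (λ r → f r * 𝟙 (isYes (r ≟ q))) ≈ f q
  ∑-𝟙-≟ʳ q f = begin
    ∑ (allFin _) (λ r → f r * 𝟙 (isYes (r ≟ q)))
      ≈⟨ ∑-allFin-single q _ (λ r r≢q → trans (*-cong refl (𝟙-≟-off r≢q)) (zeroʳ (f r))) ⟩
    f q * 𝟙 (isYes (q ≟ q))   ≈⟨ trans (*-cong refl (𝟙-≟-diag q)) (*-identityʳ (f q)) ⟩
    f q                       ∎

_⇒ᵇ_ : Bool → Bool → Bool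
false ⇒ᵇ _ = true
true  ⇒ᵇ c = c

-- The operations of Data.Fin.Subset at a single coordinate, defined through singletons so that
-- (a ∷ p) ─ (c ∷ q) reduces to (a ─₁ c) ∷ (p ─ q), and likewise for ⊕.
_─₁_ _⊕₁_ : Bool → Bool → Bool
a ─₁ c = head ((a ∷ []) ─ (c ∷ []))
a ⊕₁ c = head ((a ∷ []) ⊕ (c ∷ []))

isYes-⊆?-∷ : ∀ {n} a c (p q : Subset n) → isYes ((a ∷ p) ⊆? (c ∷ q)) ≡ (a ⇒ᵇ c) ∧ isYes (p ⊆? q)
isYes-⊆?-∷ false c     p q = ⌊⌋-map′ _ _ (p ⊆? q)
isYes-⊆?-∷ true  false p q = ≡.refl
isYes-⊆?-∷ true  true  p q = ⌊⌋-map′ _ _ (p ⊆? q)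

module Coordinate {c ℓ} (R : CommutativeSemiring c ℓ) (m : ℕ) (b : Fin m) where
  open CommutativeSemiring R hiding (zero)
  open Sums R
  open import Relation.Binary.Reasoning.Setoid setoid
  open import Algebra.Solver.Ring.NaturalCoefficients.Default R using (solve; _:+_; _:*_; _:=_; con)

  Mat₁ : Set c
  Mat₁ = Fin m → Fin m → Carrier

  _⊙_ : Mat₁ → Mat₁ → Mat₁
  (M ⊙ N) p q = ∑ (allFin m) (λ r → M p r * N r q)

  rel₁ : Bool → Fin m → Fin m → Bool
  rel₁ t p q = isYes (p ≟ q) xor t

  A₁ : Bool → Mat₁
  A₁ t p q = 𝟙 (rel₁ t p q)

  E₁ : Bool → Mat₁
  E₁ t p q = 𝟙 (isYes (p ≟ q) ∧ rel₁ t b p)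

  k₁ : Bool → ℕ
  k₁ t = count (rel₁ t b) (allFin m)

  B₁ : Bool → Bool → Bool → Mat₁
  B₁ g h i p q = ∑ (true ∷ false ∷ [])
    (λ j → if ((g ⊕₁ i) ⇒ᵇ j) ∧ (j ⇒ᵇ h) then ((E₁ g ⊙ A₁ j) ⊙ E₁ i) p q else 0#)

  C₁ : Bool → Mat₁
  C₁ g p q = ∑ (true ∷ false ∷ []) (λ i → ι (k₁ (g ─₁ i)) * B₁ i (g ∧ i) i p q)

  σ : Bool → Fin m → Carrier
  σ t p = 𝟙 (rel₁ t b p)

  δ : Mat₁
  δ p q = 𝟙 (isYes (p ≟ q))

  A₁-false≈δ : ∀ p q → A₁ false p q ≈ δ p q
  A₁-false≈δ p q = reflexive (≡.cong 𝟙 (xor-identityʳ _))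

  E₁-⊙ : ∀ t M p q → (E₁ t ⊙ M) p q ≈ σ t p * M p q
  E₁-⊙ t M p q = begin
    ∑ (allFin m) (λ r → 𝟙 (isYes (p ≟ r) ∧ rel₁ t b p) * M r q)
      ≈⟨ ∑-cong (allFin m) (λ r → trans (*-cong (𝟙-∧ _ _) refl) (*-assoc _ _ _)) ⟩
    ∑ (allFin m) (λ r → δ p r * (σ t p * M r q))
      ≈⟨ ∑-𝟙-≟ˡ p (λ r → σ t p * M r q) ⟩
    σ t p * M p q ∎

  ⊙-E₁ : ∀ t M p q → (M ⊙ E₁ t) p q ≈ M p q * σ t q
  ⊙-E₁ t M p q = begin
    ∑ (allFin m) (λ r → M p r * 𝟙 (isYes (r ≟ q) ∧ rel₁ t b r))
      ≈⟨ ∑-cong (allFin m) (λ r →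
           trans (*-cong refl (trans (𝟙-∧ _ _) (*-comm _ _))) (sym (*-assoc _ _ _))) ⟩
    ∑ (allFin m) (λ r → (M p r * σ t r) * δ r q)
      ≈⟨ ∑-𝟙-≟ʳ q (λ r → M p r * σ t r) ⟩
    M p q * σ t q ∎

  E₁-⊙-E₁ : ∀ g j i p q → ((E₁ g ⊙ A₁ j) ⊙ E₁ i) p q ≈ σ g p * A₁ j p q * σ i q
  E₁-⊙-E₁ g j i p q = trans (⊙-E₁ i (E₁ g ⊙ A₁ j) p q) (*-cong (E₁-⊙ g (A₁ j) p q) refl)

  σ-δ-transport : ∀ t p q → σ t p * δ p q ≈ δ p q * σ t q
  σ-δ-transport t p q with p ≟ q
  ... | yes ≡.refl = *-comm _ _
  ... | no  _      = trans (zeroʳ _) (sym (zeroˡ _))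

  σ-false-δ : ∀ p q → σ false p * δ p q * σ false q ≈ σ false p * σ false q
  σ-false-δ p q with b ≟ p | b ≟ q | p ≟ q
  ... | yes ≡.refl | yes ≡.refl | yes _   = *-identityʳ _
  ... | yes ≡.refl | yes ≡.refl | no p≢p  = contradiction ≡.refl p≢p
  ... | yes _      | no _       | _       = trans (zeroʳ _) (sym (zeroʳ _))
  ... | no _       | _          | _       = trans (*-assoc _ _ _) (trans (zeroˡ _) (sym (zeroˡ _)))

  σδσ-cover : ∀ p q → σ true p * δ p q * σ true q + σ false p * δ p q * σ false q ≈ δ p q
  σδσ-cover p q = begin
    σ true p * δ p q * σ true q + σ false p * δ p q * σ false q
      ≈⟨ +-cong (moved true) (moved false) ⟩
    δ p q * σ true q + δ p q * σ false q   ≈⟨ sym (distribˡ _ _ _) ⟩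
    δ p q * (σ true q + σ false q)         ≈⟨ *-cong refl (𝟙-xor-cover (isYes (b ≟ q))) ⟩
    δ p q * 1#                             ≈⟨ *-identityʳ _ ⟩
    δ p q                                  ∎
    where
    moved : ∀ t → σ t p * δ p q * σ t q ≈ δ p q * σ t q
    moved t = trans (*-cong (σ-δ-transport t p q) refl) (trans (*-assoc _ _ _) (*-cong refl (𝟙-idem _)))

  ∑-σ-false : ∑ (allFin m) (σ false) ≈ 1#
  ∑-σ-false = begin
    ∑ (allFin m) (σ false)
      ≈⟨ ∑-cong (allFin m) (λ r → trans (A₁-false≈δ b r) (sym (*-identityʳ _))) ⟩
    ∑ (allFin m) (λ r → δ b r * 1#)
      ≈⟨ ∑-𝟙-≟ˡ b (λ _ → 1#) ⟩
    1# ∎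

  ι-k₁-false : ι (k₁ false) ≈ 1#
  ι-k₁-false = trans (ι-count (rel₁ false b) (allFin m)) ∑-σ-false

  B₁-diag-false : ∀ t p q → B₁ t false t p q ≈ σ t p * δ p q * σ t q
  B₁-diag-false t p q = begin
    B₁ t false t p q                      ≈⟨ diagonal t ⟩
    σ t p * A₁ false p q * σ t q          ≈⟨ *-cong (*-cong refl (A₁-false≈δ p q)) refl ⟩
    σ t p * δ p q * σ t q                 ∎
    where
    diagonal : ∀ t → B₁ t false t p q ≈ σ t p * A₁ false p q * σ t q
    diagonal true  = trans (+-identityˡ _) (trans (+-identityʳ _) (E₁-⊙-E₁ true false true p q))
    diagonal false = trans (+-identityˡ _) (trans (+-identityʳ _) (E₁-⊙-E₁ false false false p q))

  B₁-diag-true : ∀ p q → B₁ true true true p q ≈ σ true p * σ true q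
  B₁-diag-true p q = begin
    B₁ true true true p q
      ≈⟨ +-cong (E₁-⊙-E₁ true true true p q) (trans (+-identityʳ _) (E₁-⊙-E₁ true false true p q)) ⟩
    σ true p * A₁ true p q * σ true q + σ true p * A₁ false p q * σ true q
      ≈⟨ trans (sym (distribʳ _ _ _)) (*-cong (sym (distribˡ _ _ _)) refl) ⟩
    σ true p * (A₁ true p q + A₁ false p q) * σ true q
      ≈⟨ *-cong (trans (*-cong refl (𝟙-xor-cover (isYes (p ≟ q)))) (*-identityʳ _)) refl ⟩
    σ true p * σ true q ∎

  C₁-false : ∀ p q → C₁ false p q ≈ δ p q
  C₁-false p q = begin
    C₁ false p q
      ≈⟨ +-cong (*-cong ι-k₁-false (B₁-diag-false true p q))
                (trans (+-identityʳ _) (*-cong ι-k₁-false (B₁-diag-false false p q))) ⟩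
    1# * (σ true p * δ p q * σ true q) + 1# * (σ false p * δ p q * σ false q)
      ≈⟨ +-cong (*-identityˡ _) (*-identityˡ _) ⟩
    σ true p * δ p q * σ true q + σ false p * δ p q * σ false q
      ≈⟨ σδσ-cover p q ⟩
    δ p q ∎

  C₁-true : ∀ p q → C₁ true p q ≈ ι (k₁ true) * (σ false p * σ false q) + σ true p * σ true q
  C₁-true p q = begin
    C₁ true p q
      ≈⟨ +-cong (*-cong ι-k₁-false (B₁-diag-true p q))
                (trans (+-identityʳ _) (*-cong refl (trans (B₁-diag-false false p q) (σ-false-δ p q)))) ⟩
    1# * (σ true p * σ true q) + ι (k₁ true) * (σ false p * σ false q)
      ≈⟨ trans (+-cong (*-identityˡ _) refl) (+-comm _ _) ⟩
    ι (k₁ true) * (σ false p * σ false q) + σ true p * σ true q ∎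

  *-orthogonal-idempotents : ∀ k a c a′ c′ {x y} → x * x ≈ x → y * y ≈ y → x * y ≈ 0#
                           → (k * (a * x) + c * y) * (k * (x * a′) + y * c′)
                             ≈ k * k * (a * a′) * x + c * c′ * y
  *-orthogonal-idempotents k a c a′ c′ {x} {y} xx≈x yy≈y xy≈0 = begin
    (k * (a * x) + c * y) * (k * (x * a′) + y * c′)
      ≈⟨ solve 7 (λ k a c a′ c′ x y →
                    (k :* (a :* x) :+ c :* y) :* (k :* (x :* a′) :+ y :* c′)
                    := k :* k :* (a :* a′) :* (x :* x) :+ (k :* (a :* c′) :+ k :* (c :* a′)) :* (x :* y)
                       :+ c :* c′ :* (y :* y))
                 refl k a c a′ c′ x y ⟩
    k * k * (a * a′) * (x * x) + (k * (a * c′) + k * (c * a′)) * (x * y) + c * c′ * (y * y)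
      ≈⟨ +-cong (+-cong (*-cong refl xx≈x) (*-cong refl xy≈0)) (*-cong refl yy≈y) ⟩
    k * k * (a * a′) * x + (k * (a * c′) + k * (c * a′)) * 0# + c * c′ * y
      ≈⟨ +-cong (trans (+-cong refl (zeroʳ _)) (+-identityʳ _)) refl ⟩
    k * k * (a * a′) * x + c * c′ * y ∎

  C₁-mul : ∀ g h p q → (C₁ g ⊙ C₁ h) p q ≈ ι (k₁ (g ∧ h)) * C₁ (g ∨ h) p q
  C₁-mul false h p q = begin
    ∑ (allFin m) (λ r → C₁ false p r * C₁ h r q)    ≈⟨ ∑-cong (allFin m) (λ r → *-cong (C₁-false p r) refl) ⟩
    ∑ (allFin m) (λ r → δ p r * C₁ h r q)           ≈⟨ ∑-𝟙-≟ˡ p (λ r → C₁ h r q) ⟩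
    C₁ h p q                                        ≈⟨ sym (trans (*-cong ι-k₁-false refl) (*-identityˡ _)) ⟩
    ι (k₁ false) * C₁ h p q                         ∎
  C₁-mul true false p q = begin
    ∑ (allFin m) (λ r → C₁ true p r * C₁ false r q) ≈⟨ ∑-cong (allFin m) (λ r → *-cong refl (C₁-false r q)) ⟩
    ∑ (allFin m) (λ r → C₁ true p r * δ r q)        ≈⟨ ∑-𝟙-≟ʳ q (C₁ true p) ⟩
    C₁ true p q                                     ≈⟨ sym (trans (*-cong ι-k₁-false refl) (*-identityˡ _)) ⟩
    ι (k₁ false) * C₁ true p q                      ∎
  C₁-mul true true p q = begin
    ∑ (allFin m) (λ r → C₁ true p r * C₁ true r q)
      ≈⟨ ∑-cong (allFin m) (λ r → trans (*-cong (C₁-true p r) (C₁-true r q)) (square r)) ⟩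
    ∑ (allFin m) (λ r → K * K * F * σ false r + T * σ true r)
      ≈⟨ trans (∑-+ (allFin m) _ _) (+-cong (∑-*ˡ (allFin m) (K * K * F) _) (∑-*ˡ (allFin m) T _)) ⟩
    K * K * F * ∑ (allFin m) (σ false) + T * ∑ (allFin m) (σ true)
      ≈⟨ +-cong (*-cong refl ∑-σ-false) (*-cong refl (sym (ι-count (rel₁ true b) (allFin m)))) ⟩
    K * K * F * 1# + T * K
      ≈⟨ solve 3 (λ K F T → K :* K :* F :* con 1 :+ T :* K := K :* (K :* F :+ T)) refl K F T ⟩
    K * (K * F + T)
      ≈⟨ *-cong refl (sym (C₁-true p q)) ⟩
    K * C₁ true p q ∎
    where
    K F T : Carrier
    K = ι (k₁ true)
    F = σ false p * σ false q
    T = σ true p * σ true q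
    square : ∀ r → (K * (σ false p * σ false r) + σ true p * σ true r)
                   * (K * (σ false r * σ false q) + σ true r * σ true q)
                   ≈ K * K * F * σ false r + T * σ true r
    square r = *-orthogonal-idempotents K (σ false p) (σ true p) (σ false q) (σ true q)
                 (𝟙-idem _) (𝟙-idem _) (𝟙-xor-disjoint (isYes (b ≟ r)))

module FactorialScheme {c ℓ} (F : Field c ℓ) where
  open Field F hiding (zero)
  open Sums commutativeSemiring
  open import Algebra.Solver.Ring.NaturalCoefficients.Default commutativeSemiring
    using (solve; _:+_; _:*_; _:=_; con)
  open import Relation.Binary.Reasoning.Setoid setoid
  open import Algebra.Properties.CommutativeSemigroup *-commutativeSemigroup
    using () renaming (interchange to *-interchange)

  ProductLaw : ∀ n (u : Fin n → ℕ) (x : X n u) (g h : Subset n) → Set ℓ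
  ProductLaw n u x g h = let open Scheme F n u x in (C g *M C h) ≈M (⟦ k (g ∩ h) ⟧ •M C (g ∪ h))

  module Unfold (n : ℕ) (u : Fin n → ℕ) (x : X n u) where
    open Scheme F n u x

    sumL≡∑ : ∀ {A : Set} (L : List A) (f : A → Carrier) → sumL L f ≡ ∑ L f
    sumL≡∑ []      f = ≡.refl
    sumL≡∑ (a ∷ L) f = ≡.cong (f a +_) (sumL≡∑ L f)

    ⟦⟧≡ι : ∀ m → ⟦ m ⟧ ≡ ι m
    ⟦⟧≡ι zero    = ≡.refl
    ⟦⟧≡ι (suc m) = ≡.cong (1# +_) (⟦⟧≡ι m)

    sumM-apply : ∀ {A : Set} (L : List A) (G : A → Mat) v w → sumM L G v w ≡ ∑ L (λ a → G a v w)
    sumM-apply []      G v w = ≡.refl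
    sumM-apply (a ∷ L) G v w = ≡.cong (G a v w +_) (sumM-apply L G v w)

    if-0M-apply : ∀ (a : Bool) (M : Mat) v w → (if a then M else 0M) v w ≡ (if a then M v w else 0#)
    if-0M-apply true  M v w = ≡.refl
    if-0M-apply false M v w = ≡.refl

  ∑-allX-separable : ∀ n (u : Fin (suc n) → ℕ) (f : X (suc n) u → Carrier)
                       (α : Fin (u zero) → Carrier) (β : X n (u ∘ suc) → Carrier)
                   → (∀ i z → f (consX i z) ≈ α i * β z)
                   → ∑ (allX (suc n) u) f ≈ ∑ (allFin (u zero)) α * ∑ (allX n (u ∘ suc)) β
  ∑-allX-separable n u = ∑-concatMap-map-separable (allFin (u zero)) (allX n (u ∘ suc)) consX

  ∑-allSub-separable : ∀ n (f : Subset (suc n) → Carrier)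
                         (α : Bool → Carrier) (β : Subset n → Carrier)
                     → (∀ t s → f (t ∷ s) ≈ α t * β s)
                     → ∑ (allSub (suc n)) f ≈ ∑ (true ∷ false ∷ []) α * ∑ (allSub n) β
  ∑-allSub-separable n f α β f≈αβ =
    trans (∑-concatMap-map-separable (allSub n) (true ∷ false ∷ []) (λ s t → t ∷ s) f β α
             (λ s t → trans (f≈αβ t s) (*-comm _ _)))
          (*-comm _ _)

  module Tensor (n : ℕ) (u : Fin (suc n) → ℕ) (x : X (suc n) u) where
    private
      module S  = Scheme F (suc n) u x
      module S′ = Scheme F n (u ∘ suc) (x ∘ suc)
      module U  = Unfold (suc n) u x
      module U′ = Unfold n (u ∘ suc) (x ∘ suc)
    open Coordinate commutativeSemiring (u zero) (x zero)

    -- A record rather than a function type, so that unification can recover M, f and M′.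
    infix 4 _≅_⊗_
    record _≅_⊗_ (M : S.Mat) (f : Mat₁) (M′ : S′.Mat) : Set ℓ where
      constructor ⊗-pointwise
      field pointwise : ∀ v w → M v w ≈ f (v zero) (w zero) * M′ (v ∘ suc) (w ∘ suc)
    open _≅_⊗_

    ⊗-*M : ∀ {M f M′ N g N′} → M ≅ f ⊗ M′ → N ≅ g ⊗ N′ → M S.*M N ≅ f ⊙ g ⊗ M′ S′.*M N′
    ⊗-*M {M} {f} {M′} {N} {g} {N′} M≅ N≅ = ⊗-pointwise λ v w → begin
      (M S.*M N) v w
        ≡⟨ U.sumL≡∑ (allX (suc n) u) _ ⟩
      ∑ (allX (suc n) u) (λ z → M v z * N z w)
        ≈⟨ ∑-allX-separable n u _ _ _ (λ i z →
             trans (*-cong (pointwise M≅ v (consX i z)) (pointwise N≅ (consX i z) w))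
                   (*-interchange _ _ _ _)) ⟩
      (f ⊙ g) (v zero) (w zero) * ∑ (allX n (u ∘ suc)) (λ z → M′ (v ∘ suc) z * N′ z (w ∘ suc))
        ≡⟨ ≡.cong ((f ⊙ g) (v zero) (w zero) *_) (≡.sym (U′.sumL≡∑ (allX n (u ∘ suc)) _)) ⟩
      (f ⊙ g) (v zero) (w zero) * (M′ S′.*M N′) (v ∘ suc) (w ∘ suc) ∎

    E*-⊗ : ∀ t g → S.E* (t ∷ g) ≅ E₁ t ⊗ S′.E* g
    E*-⊗ t g = ⊗-pointwise λ v w →
      𝟙-∧-interchange (isYes (v zero ≟ w zero)) (eqX (v ∘ suc) (w ∘ suc))
                      (rel₁ t (x zero) (v zero)) (relR g (x ∘ suc) (v ∘ suc))

    A-⊗ : ∀ t g → S.A (t ∷ g) ≅ A₁ t ⊗ S′.A g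
    A-⊗ t g = ⊗-pointwise λ v w → 𝟙-∧ (rel₁ t (v zero) (w zero)) (relR g (v ∘ suc) (w ∘ suc))

    ι-k-⊗ : ∀ t g → ι (S.k (t ∷ g)) ≈ ι (k₁ t) * ι (S′.k g)
    ι-k-⊗ t g = begin
      ι (S.k (t ∷ g))
        ≈⟨ ι-count _ (allX (suc n) u) ⟩
      ∑ (allX (suc n) u) (𝟙 ∘ relR (t ∷ g) x)
        ≈⟨ ∑-allX-separable n u _ _ _ (λ i z → 𝟙-∧ (rel₁ t (x zero) i) (relR g (x ∘ suc) z)) ⟩
      ∑ (allFin (u zero)) (σ t) * ∑ (allX n (u ∘ suc)) (𝟙 ∘ relR g (x ∘ suc))
        ≈⟨ sym (*-cong (ι-count _ (allFin (u zero))) (ι-count _ (allX n (u ∘ suc)))) ⟩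
      ι (k₁ t) * ι (S′.k g) ∎

    B-⊗ : ∀ g₀ g h₀ h i₀ i → S.B (g₀ ∷ g) (h₀ ∷ h) (i₀ ∷ i) ≅ B₁ g₀ h₀ i₀ ⊗ S′.B g h i
    B-⊗ g₀ g h₀ h i₀ i = ⊗-pointwise λ v w → begin
      S.B (g₀ ∷ g) (h₀ ∷ h) (i₀ ∷ i) v w
        ≡⟨ U.sumM-apply (allSub (suc n)) summand v w ⟩
      ∑ (allSub (suc n)) (λ j → summand j v w)
        ≈⟨ ∑-allSub-separable n _ _ (λ j → summand′ j (v ∘ suc) (w ∘ suc)) (separate v w) ⟩
      B₁ g₀ h₀ i₀ (v zero) (w zero) * ∑ (allSub n) (λ j → summand′ j (v ∘ suc) (w ∘ suc))
        ≡⟨ ≡.cong (B₁ g₀ h₀ i₀ (v zero) (w zero) *_)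
                  (≡.sym (U′.sumM-apply (allSub n) summand′ (v ∘ suc) (w ∘ suc))) ⟩
      B₁ g₀ h₀ i₀ (v zero) (w zero) * S′.B g h i (v ∘ suc) (w ∘ suc) ∎
      where
      summand : Subset (suc n) → S.Mat
      summand j = if isYes (((g₀ ∷ g) ⊕ (i₀ ∷ i)) ⊆? j) ∧ isYes (j ⊆? (h₀ ∷ h))
                    then (S.E* (g₀ ∷ g) S.*M S.A j) S.*M S.E* (i₀ ∷ i) else S.0M
      summand′ : Subset n → S′.Mat
      summand′ j = if isYes ((g ⊕ i) ⊆? j) ∧ isYes (j ⊆? h)
                     then (S′.E* g S′.*M S′.A j) S′.*M S′.E* i else S′.0M
      separate : ∀ v w j₀ j → summand (j₀ ∷ j) v w
                              ≈ (if ((g₀ ⊕₁ i₀) ⇒ᵇ j₀) ∧ (j₀ ⇒ᵇ h₀)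
                                   then ((E₁ g₀ ⊙ A₁ j₀) ⊙ E₁ i₀) (v zero) (w zero) else 0#)
                                * summand′ j (v ∘ suc) (w ∘ suc)
      separate v w j₀ j = begin
        summand (j₀ ∷ j) v w
          ≡⟨ U.if-0M-apply cond P v w ⟩
        (if cond then P v w else 0#)
          ≡⟨ ≡.cong (λ d → if d then P v w else 0#) cond≡ ⟩
        (if (lo ∧ lo′) ∧ (hi ∧ hi′) then P v w else 0#)
          ≈⟨ if-∧-interchange lo lo′ hi hi′ (pointwise P-⊗ v w) ⟩
        (if lo ∧ hi then p₁ else 0#) * (if lo′ ∧ hi′ then P′ (v ∘ suc) (w ∘ suc) else 0#)
          ≡⟨ ≡.cong ((if lo ∧ hi then p₁ else 0#) *_)
                    (≡.sym (U′.if-0M-apply (lo′ ∧ hi′) P′ (v ∘ suc) (w ∘ suc))) ⟩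
        (if lo ∧ hi then p₁ else 0#) * summand′ j (v ∘ suc) (w ∘ suc) ∎
        where
        cond lo lo′ hi hi′ : Bool
        cond = isYes (((g₀ ∷ g) ⊕ (i₀ ∷ i)) ⊆? (j₀ ∷ j)) ∧ isYes ((j₀ ∷ j) ⊆? (h₀ ∷ h))
        lo  = (g₀ ⊕₁ i₀) ⇒ᵇ j₀
        lo′ = isYes ((g ⊕ i) ⊆? j)
        hi  = j₀ ⇒ᵇ h₀
        hi′ = isYes (j ⊆? h)
        cond≡ : cond ≡ (lo ∧ lo′) ∧ (hi ∧ hi′)
        cond≡ = ≡.cong₂ _∧_ (isYes-⊆?-∷ (g₀ ⊕₁ i₀) j₀ (g ⊕ i) j) (isYes-⊆?-∷ j₀ h₀ j h)
        P : S.Mat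
        P = (S.E* (g₀ ∷ g) S.*M S.A (j₀ ∷ j)) S.*M S.E* (i₀ ∷ i)
        P′ : S′.Mat
        P′ = (S′.E* g S′.*M S′.A j) S′.*M S′.E* i
        p₁ : Carrier
        p₁ = ((E₁ g₀ ⊙ A₁ j₀) ⊙ E₁ i₀) (v zero) (w zero)
        P-⊗ : P ≅ (E₁ g₀ ⊙ A₁ j₀) ⊙ E₁ i₀ ⊗ P′
        P-⊗ = ⊗-*M (⊗-*M (E*-⊗ g₀ g) (A-⊗ j₀ j)) (E*-⊗ i₀ i)

    C-⊗ : ∀ g₀ g → S.C (g₀ ∷ g) ≅ C₁ g₀ ⊗ S′.C g
    C-⊗ g₀ g = ⊗-pointwise λ v w → begin
      S.C (g₀ ∷ g) v w
        ≡⟨ U.sumM-apply (allSub (suc n)) summand v w ⟩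
      ∑ (allSub (suc n)) (λ i → summand i v w)
        ≈⟨ ∑-allSub-separable n _ _ _ (separate v w) ⟩
      C₁ g₀ (v zero) (w zero) * ∑ (allSub n) (λ i → summand′ i (v ∘ suc) (w ∘ suc))
        ≡⟨ ≡.cong (C₁ g₀ (v zero) (w zero) *_)
                  (≡.sym (U′.sumM-apply (allSub n) summand′ (v ∘ suc) (w ∘ suc))) ⟩
      C₁ g₀ (v zero) (w zero) * S′.C g (v ∘ suc) (w ∘ suc) ∎
      where
      summand : Subset (suc n) → S.Mat
      summand i = S.⟦ S.k ((g₀ ∷ g) ─ i) ⟧ S.•M S.B i ((g₀ ∷ g) ∩ i) i
      summand′ : Subset n → S′.Mat
      summand′ i = S′.⟦ S′.k (g ─ i) ⟧ S′.•M S′.B i (g ∩ i) i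
      separate : ∀ v w t i → summand (t ∷ i) v w
                             ≈ (ι (k₁ (g₀ ─₁ t)) * B₁ t (g₀ ∧ t) t (v zero) (w zero)) * summand′ i (v ∘ suc) (w ∘ suc)
      separate v w t i = begin
        summand (t ∷ i) v w
          ≈⟨ *-cong (trans (reflexive (U.⟦⟧≡ι (S.k ((g₀ ─₁ t) ∷ (g ─ i))))) (ι-k-⊗ (g₀ ─₁ t) (g ─ i)))
                    (pointwise (B-⊗ t i (g₀ ∧ t) (g ∩ i) t i) v w) ⟩
        (κ₁ * ι κ′) * (β₁ * β′)    ≈⟨ *-interchange _ _ _ _ ⟩
        (κ₁ * β₁) * (ι κ′ * β′)    ≈⟨ *-cong refl (*-cong (reflexive (≡.sym (U′.⟦⟧≡ι κ′))) refl) ⟩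
        (κ₁ * β₁) * summand′ i (v ∘ suc) (w ∘ suc) ∎
        where
        κ′ : ℕ
        κ′ = S′.k (g ─ i)
        κ₁ β₁ β′ : Carrier
        κ₁ = ι (k₁ (g₀ ─₁ t))
        β₁ = B₁ t (g₀ ∧ t) t (v zero) (w zero)
        β′ = S′.B i (g ∩ i) i (v ∘ suc) (w ∘ suc)

    C-mul-step : ∀ g₀ g h₀ h → ProductLaw n (u ∘ suc) (x ∘ suc) g h
               → ProductLaw (suc n) u x (g₀ ∷ g) (h₀ ∷ h)
    C-mul-step g₀ g h₀ h tail-law v w = begin
      (S.C (g₀ ∷ g) S.*M S.C (h₀ ∷ h)) v w
        ≈⟨ pointwise (⊗-*M (C-⊗ g₀ g) (C-⊗ h₀ h)) v w ⟩
      (C₁ g₀ ⊙ C₁ h₀) p q * (S′.C g S′.*M S′.C h) v′ w′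
        ≈⟨ *-cong (C₁-mul g₀ h₀ p q) (tail-law v′ w′) ⟩
      (ι (k₁ (g₀ ∧ h₀)) * C₁ (g₀ ∨ h₀) p q) * (S′.⟦ S′.k (g ∩ h) ⟧ * S′.C (g ∪ h) v′ w′)
        ≈⟨ *-interchange _ _ _ _ ⟩
      (ι (k₁ (g₀ ∧ h₀)) * S′.⟦ S′.k (g ∩ h) ⟧) * (C₁ (g₀ ∨ h₀) p q * S′.C (g ∪ h) v′ w′)
        ≈⟨ *-cong (trans (*-cong refl (reflexive (U′.⟦⟧≡ι (S′.k (g ∩ h)))))
                         (sym (ι-k-⊗ (g₀ ∧ h₀) (g ∩ h))))
                  (sym (pointwise (C-⊗ (g₀ ∨ h₀) (g ∪ h)) v w)) ⟩
      ι (S.k (G ∩ H)) * S.C (G ∪ H) v w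
        ≡⟨ ≡.cong (_* S.C (G ∪ H) v w) (≡.sym (U.⟦⟧≡ι (S.k (G ∩ H)))) ⟩
      S.⟦ S.k (G ∩ H) ⟧ * S.C (G ∪ H) v w ∎
      where
      G H : Subset (suc n)
      G = g₀ ∷ g
      H = h₀ ∷ h
      p q : Fin (u zero)
      p = v zero
      q = w zero
      v′ w′ : X n (u ∘ suc)
      v′ = v ∘ suc
      w′ = w ∘ suc

  -- With no coordinates, C [] v w unfolds to a closed expression in 1# and 0#.
  C-dim0 : (u : Fin 0 → ℕ) (x : X 0 u) → ∀ v w → Scheme.C F 0 u x [] v w ≈ 1#
  C-dim0 u x v w =
    solve 0 ((con 1 :+ con 0) :* (((con 1 :* con 1 :+ con 0) :* con 1 :+ con 0) :+ con 0) :+ con 0 := con 1) refl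

  C-mul : ∀ n u x g h → ProductLaw n u x g h
  C-mul zero    u x []       []       v w =
    trans (+-identityʳ _) (trans (*-cong (C-dim0 u x v (λ ())) (C-dim0 u x (λ ()) w))
                                 (sym (*-cong (+-identityʳ 1#) (C-dim0 u x v w))))
  C-mul (suc n) u x (g₀ ∷ g) (h₀ ∷ h) =
    Tensor.C-mul-step n u x g₀ g h₀ h (C-mul n (u ∘ suc) (x ∘ suc) g h)

lemma5p13 : ∀ {c ℓ : Level} (F : Field c ℓ) (n : ℕ) (u : Fin n → ℕ)
              → 1 ≤ n → (∀ a → 2 ≤ u a) → (x : X n u)
              → (g h : Subset n) → (g ∪ h) ⊆ dTilde n u
              → let open Scheme F n u x
                in (C g *M C h) ≈M (⟦ k (g ∩ h) ⟧ •M C (g ∪ h))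
lemma5p13 F n u _ _ x g h _ = FactorialScheme.C-mul F n u x g h
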